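{- In the non-deterministic $\lambda$-calculus $\Lambda_\oplus$ the following hold: (1) $\to_\oplus$ satisfies head factorization: $\to_\oplus^*\subseteq\to_{\mathsf h\oplus}^*\cdot\to_{\neg\mathsf h\oplus}^*$; (2) $\to_{\neg\mathsf h\beta}\cdot\mapsto_\oplus\ \subseteq\ \to_{\mathsf h\oplus}\cdot\to_\beta^=$; (3) $\mapsto_\oplus$ is substitutive. Consequently $\to_\beta\cup\to_\oplus$ satisfies head factorization: $(\to_\beta\cup\to_\oplus)^*\subseteq(\to_{\mathsf h\beta}\cup\to_{\mathsf h\oplus})^*\cdot(\to_{\neg\mathsf h\beta}\cup\to_{\neg\mathsf h\oplus})^*$.
   Context: Terms of $\Lambda_\oplus$: $t::=x\mid\oplus\mid\lambda x.t\mid tt$, where $\oplus$ is a constant; modulo $\alpha$-equivalence, with capture-avoiding substitution $t\{x:=q\}$. Contexts: $C::=\langle\cdot\rangle\mid tC\mid Ct\mid\lambda x.C$. The contextual closure $\to_\rho$ of a root relation $\mapsto_\rho$: $C\langle r\rangle\to_\rho C\langle r'\rangle$ for $r\mapsto_\rho r'$. Rules: $(\lambda x.p)q\mapsto_\beta p\{x:=q\}$; $\oplus tp\mapsto_\oplus t$ and $\oplus tp\mapsto_\oplus p$. Head contexts: $H::=\lambda x_1\dots\lambda x_k.\langle\cdot\rangle t_1\dots t_n$ ($k,n\ge0$); non-head contexts are the other contexts. $\to_{\mathsf h\rho}$ (resp. $\to_{\neg\mathsf h\rho}$) is the closure of $\mapsto_\rho$ under head (resp. non-head) contexts. A root relation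 $\mapsto$ is substitutive if $r\mapsto r'$ implies $r\{x:=q\}\mapsto r'\{x:=q\}$ for all $x,q$. $\to^*$, $\to^=$ denote reflexive-transitive and reflexive closure; $R\cdot S$ is composition. -}

module Defs where

open import Data.Nat using (ℕ; zero; suc; _≟_)
open import Data.Product using (∃; _×_)
open import Data.Sum using (_⊎_)
open import Data.Unit using (⊤)
open import Relation.Nullary using (¬_; yes; no)
open import Relation.Binary.Core using (Rel)
open import Level using (0ℓ)

-- Terms of Λ⊕, with de Bruijn indices (terms are thus taken modulo α-equivalence).
data Tm : Set where
  var  : ℕ → Tm
  plus : Tm
  lam  : Tm → Tm
  app  : Tm → Tm → Tm

ext : (ℕ → ℕ) → ℕ → ℕ
ext ρ zero    = zero
ext ρ (suc n) = suc (ρ n)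

rename : (ℕ → ℕ) → Tm → Tm
rename ρ (var n)   = var (ρ n)
rename ρ plus      = plus
rename ρ (lam t)   = lam (rename (ext ρ) t)
rename ρ (app t u) = app (rename ρ t) (rename ρ u)

exts : (ℕ → Tm) → ℕ → Tm
exts σ zero    = var zero
exts σ (suc n) = rename suc (σ n)

sub : (ℕ → Tm) → Tm → Tm
sub σ (var n)   = σ n
sub σ plus      = plus
sub σ (lam t)   = lam (sub (exts σ) t)
sub σ (app t u) = app (sub σ t) (sub σ u)

sub0 : Tm → ℕ → Tm
sub0 q zero    = q
sub0 q (suc n) = var n

_[0:=_] : Tm → Tm → Tm
p [0:= q ] = sub (sub0 q) p

single : ℕ → Tm → ℕ → Tm
single x q y with y ≟ x
... | yes _ = q
... | no  _ = var y

_[_:=_] : Tm → ℕ → Tm → Tm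
t [ x := q ] = sub (single x q) t

data _↦β_ : Tm → Tm → Set where
  beta : ∀ p q → app (lam p) q ↦β (p [0:= q ])

data _↦⊕_ : Tm → Tm → Set where
  plusL : ∀ t p → app (app plus t) p ↦⊕ t
  plusR : ∀ t p → app (app plus t) p ↦⊕ p

data Ctx : Set where
  hole : Ctx
  appR : Tm → Ctx → Ctx
  appL : Ctx → Tm → Ctx
  lamC : Ctx → Ctx

plug : Ctx → Tm → Tm
plug hole       r = r
plug (appR t C) r = app t (plug C r)
plug (appL C t) r = app (plug C r) t
plug (lamC C)   r = lam (plug C r)

-- Head contexts  H ::= λx1…λxk.⟨⟩ t1 … tn
data Spine : Ctx → Set where
  hole : Spine hole
  appL : ∀ {C} t → Spine C → Spine (appL C t)

data IsHead : Ctx → Set where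
  spine : ∀ {C} → Spine C → IsHead C
  lamC  : ∀ {C} → IsHead C → IsHead (lamC C)

NonHead : Ctx → Set
NonHead C = ¬ IsHead C

AnyCtx : Ctx → Set
AnyCtx _ = ⊤

data Closure (P : Ctx → Set) (R : Rel Tm 0ℓ) : Rel Tm 0ℓ where
  ctx : ∀ (C : Ctx) {r r'} → P C → R r r' → Closure P R (plug C r) (plug C r')

_→β_ _→⊕_ _→hβ_ _→h⊕_ _→¬hβ_ _→¬h⊕_ : Rel Tm 0ℓ
_→β_   = Closure AnyCtx  _↦β_
_→⊕_   = Closure AnyCtx  _↦⊕_
_→hβ_  = Closure IsHead  _↦β_
_→h⊕_  = Closure IsHead  _↦⊕_
_→¬hβ_ = Closure NonHead _↦β_
_→¬h⊕_ = Closure NonHead _↦⊕_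

_·_ : Rel Tm 0ℓ → Rel Tm 0ℓ → Rel Tm 0ℓ
(R · S) a c = ∃ λ b → R a b × S b c

_∪_ : Rel Tm 0ℓ → Rel Tm 0ℓ → Rel Tm 0ℓ
(R ∪ S) a b = R a b ⊎ S a b

Substitutive : Rel Tm 0ℓ → Set
Substitutive R = ∀ {r r'} → R r r' → ∀ (x : ℕ) (q : Tm) → R (r [ x := q ]) (r' [ x := q ])

-- Parts (2) and (3) are local facts about the root rule ↦⊕.
-- (2) holds because a ⊕-redex ⊕ t p whose preceding β-step was non-head has
-- that β-step inside t or p. The ⊕-step can then be fired first (it is a head
-- step), after which at most one β-step is left. (3) holds because ↦⊕ ignores
-- the shape of its arguments.
--
-- Parts (1) and (4) are proved uniformly. We do not derive (4) from (1)-(3)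
-- via the modularity theorem; we run the same factorization argument for both.
-- The module HeadFactorization is parameterised by a type βEnabled: its root
-- relation is ↦⊕ together with ↦β when βEnabled is inhabited. Inside it we
-- define a factored reduction  t ⇛ u : head steps followed by an "internal"
-- parallel reduction. Internal reductions are closed under renaming and
-- substitution. Using this we show that ⇛ absorbs any further step
-- (appendStep). Hence every reduction sequence factors.

module Submission where

open import Defs
open import Data.Product using (_×_; _,_; ∃)
open import Data.Sum using (inj₁; inj₂)
open import Data.Nat using (ℕ; zero; suc)
open import Data.Unit using (⊤; tt)
open import Data.Empty using (⊥; ⊥-elim)
open import Function using (_∘_; id)
open import Relation.Nullary using (¬_)
open import Relation.Binary.Core using (_⇒_; Rel)
open import Relation.Binary.PropositionalEquality using (_≡_; refl; sym; trans; cong; cong₂; subst)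
open import Relation.Binary.Construct.Closure.ReflexiveTransitive using (Star; ε; _◅_; _◅◅_; gmap)
open import Relation.Binary.Construct.Closure.Reflexive using (ReflClosure; [_]) renaming (refl to rrefl)
open import Level using (0ℓ)

ext-cong : ∀ {ρ ρ' : ℕ → ℕ} → (∀ x → ρ x ≡ ρ' x) → ∀ x → ext ρ x ≡ ext ρ' x
ext-cong h zero    = refl
ext-cong h (suc x) = cong suc (h x)

rename-cong : ∀ {ρ ρ' : ℕ → ℕ} → (∀ x → ρ x ≡ ρ' x) → ∀ t → rename ρ t ≡ rename ρ' t
rename-cong h (var x)   = cong var (h x)
rename-cong h plus      = refl
rename-cong h (lam t)   = cong lam (rename-cong (ext-cong h) t)
rename-cong h (app t u) = cong₂ app (rename-cong h t) (rename-cong h u)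

exts-cong : ∀ {σ τ : ℕ → Tm} → (∀ x → σ x ≡ τ x) → ∀ x → exts σ x ≡ exts τ x
exts-cong h zero    = refl
exts-cong h (suc x) = cong (rename suc) (h x)

sub-cong : ∀ {σ τ : ℕ → Tm} → (∀ x → σ x ≡ τ x) → ∀ t → sub σ t ≡ sub τ t
sub-cong h (var x)   = h x
sub-cong h plus      = refl
sub-cong h (lam t)   = cong lam (sub-cong (exts-cong h) t)
sub-cong h (app t u) = cong₂ app (sub-cong h t) (sub-cong h u)

rename-rename : ∀ (ρ ρ' : ℕ → ℕ) t → rename ρ (rename ρ' t) ≡ rename (ρ ∘ ρ') t
rename-rename ρ ρ' (var x)   = refl
rename-rename ρ ρ' plus      = refl
rename-rename ρ ρ' (lam t)   =
  cong lam (trans (rename-rename (ext ρ) (ext ρ') t) (rename-cong ext-∘ t))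
  where
  ext-∘ : ∀ x → ext ρ (ext ρ' x) ≡ ext (ρ ∘ ρ') x
  ext-∘ zero    = refl
  ext-∘ (suc x) = refl
rename-rename ρ ρ' (app t u) = cong₂ app (rename-rename ρ ρ' t) (rename-rename ρ ρ' u)

sub-rename : ∀ (σ : ℕ → Tm) (ρ : ℕ → ℕ) t → sub σ (rename ρ t) ≡ sub (σ ∘ ρ) t
sub-rename σ ρ (var x)   = refl
sub-rename σ ρ plus      = refl
sub-rename σ ρ (lam t)   =
  cong lam (trans (sub-rename (exts σ) (ext ρ) t) (sub-cong exts-ext t))
  where
  exts-ext : ∀ x → exts σ (ext ρ x) ≡ exts (σ ∘ ρ) x
  exts-ext zero    = refl
  exts-ext (suc x) = refl
sub-rename σ ρ (app t u) = cong₂ app (sub-rename σ ρ t) (sub-rename σ ρ u)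

rename-sub : ∀ (ρ : ℕ → ℕ) (σ : ℕ → Tm) t → rename ρ (sub σ t) ≡ sub (rename ρ ∘ σ) t
rename-sub ρ σ (var x)   = refl
rename-sub ρ σ plus      = refl
rename-sub ρ σ (lam t)   =
  cong lam (trans (rename-sub (ext ρ) (exts σ) t) (sub-cong ext-exts t))
  where
  ext-exts : ∀ x → rename (ext ρ) (exts σ x) ≡ exts (rename ρ ∘ σ) x
  ext-exts zero    = refl
  ext-exts (suc x) = trans (rename-rename (ext ρ) suc (σ x)) (sym (rename-rename suc ρ (σ x)))
rename-sub ρ σ (app t u) = cong₂ app (rename-sub ρ σ t) (rename-sub ρ σ u)

sub-sub : ∀ (τ σ : ℕ → Tm) t → sub τ (sub σ t) ≡ sub (sub τ ∘ σ) t
sub-sub τ σ (var x)   = refl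
sub-sub τ σ plus      = refl
sub-sub τ σ (lam t)   =
  cong lam (trans (sub-sub (exts τ) (exts σ) t) (sub-cong exts-exts t))
  where
  exts-exts : ∀ x → sub (exts τ) (exts σ x) ≡ exts (sub τ ∘ σ) x
  exts-exts zero    = refl
  exts-exts (suc x) = trans (sub-rename (exts τ) suc (σ x)) (sym (rename-sub suc τ (σ x)))
sub-sub τ σ (app t u) = cong₂ app (sub-sub τ σ t) (sub-sub τ σ u)

sub-id : ∀ t → sub var t ≡ t
sub-id (var x)   = refl
sub-id plus      = refl
sub-id (lam t)   = cong lam (trans (sub-cong exts-var t) (sub-id t))
  where
  exts-var : ∀ x → exts var x ≡ var x
  exts-var zero    = refl
  exts-var (suc x) = refl
sub-id (app t u) = cong₂ app (sub-id t) (sub-id u)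

ren-[0:=] : ∀ ρ p q → rename ρ (p [0:= q ]) ≡ (rename (ext ρ) p) [0:= rename ρ q ]
ren-[0:=] ρ p q =
  trans (rename-sub ρ (sub0 q) p)
        (trans (sub-cong pointwise p) (sym (sub-rename (sub0 (rename ρ q)) (ext ρ) p)))
  where
  pointwise : ∀ x → rename ρ (sub0 q x) ≡ sub0 (rename ρ q) (ext ρ x)
  pointwise zero    = refl
  pointwise (suc x) = refl

sub-[0:=] : ∀ σ p q → sub σ (p [0:= q ]) ≡ (sub (exts σ) p) [0:= sub σ q ]
sub-[0:=] σ p q =
  trans (sub-sub σ (sub0 q) p)
        (trans (sub-cong pointwise p) (sym (sub-sub (sub0 (sub σ q)) (exts σ) p)))
  where
  pointwise : ∀ x → sub σ (sub0 q x) ≡ sub (sub0 (sub σ q)) (exts σ x)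
  pointwise zero    = refl
  pointwise (suc x) = sym (trans (sub-rename (sub0 (sub σ q)) suc (σ x)) (sub-id (σ x)))

module HeadFactorization (βEnabled : Set) where

  data Root : Rel Tm 0ℓ where
    rβ : ∀ {r r'} → βEnabled → r ↦β r' → Root r r'
    r⊕ : ∀ {r r'} → r ↦⊕ r' → Root r r'

  data Step : Rel Tm 0ℓ where
    root : ∀ {t t'} → Root t t' → Step t t'
    lamS : ∀ {t t'} → Step t t' → Step (lam t) (lam t')
    appL : ∀ {t t' u} → Step t t' → Step (app t u) (app t' u)
    appR : ∀ {t u u'} → Step u u' → Step (app t u) (app t u')

  data WeakHead : Rel Tm 0ℓ where
    root : ∀ {t t'} → Root t t' → WeakHead t t'
    appL : ∀ {t t' u} → WeakHead t t' → WeakHead (app t u) (app t' u)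

  data Head : Rel Tm 0ℓ where
    weak : ∀ {t t'} → WeakHead t t' → Head t t'
    lamH : ∀ {t t'} → Head t t' → Head (lam t) (lam t')

  -- An internal reduction Internal reduces, in parallel, only positions that
  -- are not head positions. InternalFn is the same for a term that sits in
  -- function position: there the body of a λ is no longer a head position, so
  -- it may be reduced arbitrarily (by a factored reduction).
  data _⇛_ : Rel Tm 0ℓ
  data Internal : Rel Tm 0ℓ
  data InternalFn : Rel Tm 0ℓ

  infix 4 _⇛_
  data _⇛_ where
    factored : ∀ {t w u} → Star Head t w → Internal w u → t ⇛ u

  data Internal where
    var  : ∀ {n} → Internal (var n) (var n)
    plus : Internal plus plus
    lam  : ∀ {t t'} → Internal t t' → Internal (lam t) (lam t')
    app  : ∀ {t t' u u'} → InternalFn t t' → u ⇛ u' → Internal (app t u) (app t' u')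

  data InternalFn where
    var  : ∀ {n} → InternalFn (var n) (var n)
    plus : InternalFn plus plus
    lam  : ∀ {t t'} → t ⇛ t' → InternalFn (lam t) (lam t')
    app  : ∀ {t t' u u'} → InternalFn t t' → u ⇛ u' → InternalFn (app t u) (app t' u')

  _⇛Fn_ : Rel Tm 0ℓ
  t ⇛Fn u = ∃ λ w → Star WeakHead t w × InternalFn w u

  ⇛-refl : ∀ t → t ⇛ t
  Internal-refl : ∀ t → Internal t t
  InternalFn-refl : ∀ t → InternalFn t t
  ⇛-refl t = factored ε (Internal-refl t)
  Internal-refl (var x)   = var
  Internal-refl plus      = plus
  Internal-refl (lam t)   = lam (Internal-refl t)
  Internal-refl (app t u) = app (InternalFn-refl t) (⇛-refl u)
  InternalFn-refl (var x)   = var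
  InternalFn-refl plus      = plus
  InternalFn-refl (lam t)   = lam (⇛-refl t)
  InternalFn-refl (app t u) = app (InternalFn-refl t) (⇛-refl u)

  Root-rename : ∀ ρ {t t'} → Root t t' → Root (rename ρ t) (rename ρ t')
  Root-rename ρ (rβ e (beta p q)) = subst (Root _) (sym (ren-[0:=] ρ p q)) (rβ e (beta _ _))
  Root-rename ρ (r⊕ (plusL t p))  = r⊕ (plusL _ _)
  Root-rename ρ (r⊕ (plusR t p))  = r⊕ (plusR _ _)

  Root-sub : ∀ σ {t t'} → Root t t' → Root (sub σ t) (sub σ t')
  Root-sub σ (rβ e (beta p q)) = subst (Root _) (sym (sub-[0:=] σ p q)) (rβ e (beta _ _))
  Root-sub σ (r⊕ (plusL t p))  = r⊕ (plusL _ _)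
  Root-sub σ (r⊕ (plusR t p))  = r⊕ (plusR _ _)

  WeakHead-rename : ∀ ρ {t t'} → WeakHead t t' → WeakHead (rename ρ t) (rename ρ t')
  WeakHead-rename ρ (root r) = root (Root-rename ρ r)
  WeakHead-rename ρ (appL w) = appL (WeakHead-rename ρ w)

  WeakHead-sub : ∀ σ {t t'} → WeakHead t t' → WeakHead (sub σ t) (sub σ t')
  WeakHead-sub σ (root r) = root (Root-sub σ r)
  WeakHead-sub σ (appL w) = appL (WeakHead-sub σ w)

  Head-rename : ∀ ρ {t t'} → Head t t' → Head (rename ρ t) (rename ρ t')
  Head-rename ρ (weak w) = weak (WeakHead-rename ρ w)
  Head-rename ρ (lamH h) = lamH (Head-rename (ext ρ) h)

  Head-sub : ∀ σ {t t'} → Head t t' → Head (sub σ t) (sub σ t')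
  Head-sub σ (weak w) = weak (WeakHead-sub σ w)
  Head-sub σ (lamH h) = lamH (Head-sub (exts σ) h)

  heads-⇛ : ∀ {t w u} → Star Head t w → w ⇛ u → t ⇛ u
  heads-⇛ hs (factored hs' d) = factored (hs ◅◅ hs') d

  ⇛-lam : ∀ {a a'} → a ⇛ a' → lam a ⇛ lam a'
  ⇛-lam (factored hs d) = factored (gmap lam lamH hs) (lam d)

  InternalFn⇛ : ∀ {t u} → InternalFn t u → t ⇛ u
  InternalFn⇛ var         = ⇛-refl _
  InternalFn⇛ plus        = ⇛-refl _
  InternalFn⇛ (lam d)     = ⇛-lam d
  InternalFn⇛ (app da db) = factored ε (app da db)

  Internal⇛InternalFn : ∀ {t u} → Internal t u → InternalFn t u
  Internal⇛InternalFn var         = var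
  Internal⇛InternalFn plus        = plus
  Internal⇛InternalFn (lam d)     = lam (factored ε d)
  Internal⇛InternalFn (app da db) = app da db

  -- ⇛ and ⇛Fn coincide: the head steps of a reduction starting from an
  -- abstraction are all under the λ, so they can be absorbed into InternalFn.
  ⇛Fn⇛ : ∀ {x y} → x ⇛Fn y → x ⇛ y
  ⇛Fn⇛ (w , ws , a) = heads-⇛ (gmap id weak ws) (InternalFn⇛ a)

  ⇛⇛Fn : ∀ {x y} → x ⇛ y → x ⇛Fn y
  ⇛⇛Fn (factored hs d) = split hs d
    where
    under-lam : ∀ {c w y} → Star Head (lam c) w → Internal w y → InternalFn (lam c) y
    under-lam ε                              (lam d) = lam (factored ε d)
    under-lam (weak (root (rβ _ ())) ◅ hs) d
    under-lam (weak (root (r⊕ ())) ◅ hs)   d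
    under-lam (lamH h ◅ hs) d with under-lam hs d
    ... | lam (factored hs' d') = lam (factored (h ◅ hs') d')

    split : ∀ {x w y} → Star Head x w → Internal w y → x ⇛Fn y
    split ε d = _ , ε , Internal⇛InternalFn d
    split (weak w ◅ hs) d with split hs d
    ... | w' , ws , a = w' , w ◅ ws , a
    split (lamH h ◅ hs) d = _ , ε , under-lam (lamH h ◅ hs) d

  ⇛-app : ∀ {x y r r'} → x ⇛ y → r ⇛ r' → app x r ⇛ app y r'
  ⇛-app dx dr with ⇛⇛Fn dx
  ... | w , ws , a = factored (gmap (λ z → app z _) (weak ∘ appL) ws) (app a dr)

  ⇛-rename : ∀ ρ {t t'} → t ⇛ t' → rename ρ t ⇛ rename ρ t'
  Internal-rename : ∀ ρ {t t'} → Internal t t' → Internal (rename ρ t) (rename ρ t')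
  InternalFn-rename : ∀ ρ {t t'} → InternalFn t t' → InternalFn (rename ρ t) (rename ρ t')
  ⇛-rename ρ (factored hs d) = factored (gmap (rename ρ) (Head-rename ρ) hs) (Internal-rename ρ d)
  Internal-rename ρ var         = var
  Internal-rename ρ plus        = plus
  Internal-rename ρ (lam d)     = lam (Internal-rename (ext ρ) d)
  Internal-rename ρ (app da db) = app (InternalFn-rename ρ da) (⇛-rename ρ db)
  InternalFn-rename ρ var         = var
  InternalFn-rename ρ plus        = plus
  InternalFn-rename ρ (lam d)     = lam (⇛-rename (ext ρ) d)
  InternalFn-rename ρ (app da db) = app (InternalFn-rename ρ da) (⇛-rename ρ db)

  _⇛Sub_ : (ℕ → Tm) → (ℕ → Tm) → Set
  σ ⇛Sub τ = ∀ x → σ x ⇛ τ x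

  exts-⇛Sub : ∀ {σ τ} → σ ⇛Sub τ → exts σ ⇛Sub exts τ
  exts-⇛Sub h zero    = ⇛-refl _
  exts-⇛Sub h (suc x) = ⇛-rename suc (h x)

  ⇛-sub : ∀ {σ τ} → σ ⇛Sub τ → ∀ {t t'} → t ⇛ t' → sub σ t ⇛ sub τ t'
  Internal-sub : ∀ {σ τ} → σ ⇛Sub τ → ∀ {t t'} → Internal t t' → sub σ t ⇛ sub τ t'
  InternalFn-sub : ∀ {σ τ} → σ ⇛Sub τ → ∀ {t t'} → InternalFn t t' → sub σ t ⇛ sub τ t'
  ⇛-sub {σ} h (factored hs d) = heads-⇛ (gmap (sub σ) (Head-sub σ) hs) (Internal-sub h d)
  Internal-sub h (var {n})   = h n
  Internal-sub h plus        = ⇛-refl _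
  Internal-sub h (lam d)     = ⇛-lam (Internal-sub (exts-⇛Sub h) d)
  Internal-sub h (app da db) = ⇛-app (InternalFn-sub h da) (⇛-sub h db)
  InternalFn-sub h (var {n})   = h n
  InternalFn-sub h plus        = ⇛-refl _
  InternalFn-sub h (lam d)     = ⇛-lam (⇛-sub (exts-⇛Sub h) d)
  InternalFn-sub h (app da db) = ⇛-app (InternalFn-sub h da) (⇛-sub h db)

  ⇛-[0:=] : ∀ {p p' q q'} → p ⇛ p' → q ⇛ q' → p [0:= q ] ⇛ p' [0:= q' ]
  ⇛-[0:=] dp dq = ⇛-sub sub0-⇛ dp
    where
    sub0-⇛ : sub0 _ ⇛Sub sub0 _
    sub0-⇛ zero    = dq
    sub0-⇛ (suc x) = ⇛-refl _

  -- The only interesting case is a root step fired on a term app a' c' that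
  -- was reached by internal reduction from app a c: then a already has the
  -- shape of the redex, so the same root step can be fired first (a head step)
  -- and the internal reductions are replayed on its contractum.
  appendStep : ∀ {t u v} → t ⇛ u → Step u v → t ⇛ v
  Internal-step : ∀ {w u v} → Internal w u → Step u v → w ⇛ v
  InternalFn-step : ∀ {w u v} → InternalFn w u → Step u v → w ⇛Fn v
  app-step : ∀ {a a' c c' v} → InternalFn a a' → c ⇛ c' → Step (app a' c') v → app a c ⇛Fn v
  appendStep (factored hs d) s = heads-⇛ hs (Internal-step d s)
  Internal-step (lam d) (lamS s)   = ⇛-lam (Internal-step d s)
  Internal-step (lam d) (root (rβ _ ()))
  Internal-step (lam d) (root (r⊕ ()))
  Internal-step (app da db) s      = ⇛Fn⇛ (app-step da db s)
  Internal-step var (root (rβ _ ()))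
  Internal-step var (root (r⊕ ()))
  Internal-step plus (root (rβ _ ()))
  Internal-step plus (root (r⊕ ()))
  InternalFn-step (lam d) (lamS s)   = _ , ε , lam (appendStep d s)
  InternalFn-step (lam d) (root (rβ _ ()))
  InternalFn-step (lam d) (root (r⊕ ()))
  InternalFn-step (app da db) s      = app-step da db s
  InternalFn-step var (root (rβ _ ()))
  InternalFn-step var (root (r⊕ ()))
  InternalFn-step plus (root (rβ _ ()))
  InternalFn-step plus (root (r⊕ ()))
  app-step da db (appL s) with InternalFn-step da s
  ... | a₁ , ws , da₁ = _ , gmap (λ z → app z _) appL ws , app da₁ db
  app-step da db (appR s) = _ , ε , app da (appendStep db s)
  app-step (lam dp) db (root (rβ e (beta p q))) with ⇛⇛Fn (⇛-[0:=] dp db)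
  ... | w , ws , a = w , root (rβ e (beta _ _)) ◅ ws , a
  app-step (app plus dx) db (root (r⊕ (plusL t p))) with ⇛⇛Fn dx
  ... | w , ws , a = w , root (r⊕ (plusL _ _)) ◅ ws , a
  app-step (app plus dx) db (root (r⊕ (plusR t p))) with ⇛⇛Fn db
  ... | w , ws , a = w , root (r⊕ (plusR _ _)) ◅ ws , a

  Steps⇛ : ∀ {t u} → Star Step t u → t ⇛ u
  Steps⇛ {t} = go (⇛-refl t)
    where
    go : ∀ {t u v} → t ⇛ u → Star Step u v → t ⇛ v
    go d ε        = d
    go d (s ◅ ss) = go (appendStep d s) ss

  Cl : (Ctx → Set) → Rel Tm 0ℓ
  Cl P = Closure P Root

  weaken : ∀ {P Q : Ctx → Set} → (∀ {C} → P C → Q C) → ∀ {t u} → Cl P t u → Cl Q t u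
  weaken f (ctx C p r) = ctx C (f p) r

  underAppL : ∀ {P Q : Ctx → Set} {c} → (∀ {C} → P C → Q (appL C c)) →
              ∀ {t u} → Cl P t u → Cl Q (app t c) (app u c)
  underAppL f (ctx C p r) = ctx (appL C _) (f p) r

  underAppR : ∀ {P Q : Ctx → Set} {c} → (∀ {C} → P C → Q (appR c C)) →
              ∀ {t u} → Cl P t u → Cl Q (app c t) (app c u)
  underAppR f (ctx C p r) = ctx (appR _ C) (f p) r

  underLam : ∀ {P Q : Ctx → Set} → (∀ {C} → P C → Q (lamC C)) →
             ∀ {t u} → Cl P t u → Cl Q (lam t) (lam u)
  underLam f (ctx C p r) = ctx (lamC C) (f p) r

  WeakHead-ctx : ∀ {t u} → WeakHead t u → Cl Spine t u
  WeakHead-ctx (root r) = ctx hole hole r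
  WeakHead-ctx (appL w) = underAppL (appL _) (WeakHead-ctx w)

  Head-ctx : ∀ {t u} → Head t u → Cl IsHead t u
  Head-ctx (weak w) = weaken spine (WeakHead-ctx w)
  Head-ctx (lamH h) = underLam lamC (Head-ctx h)

  NotSpine : Ctx → Set
  NotSpine C = ¬ Spine C

  nonHead-lam : ∀ {C} → NonHead C → NonHead (lamC C)
  nonHead-lam nh (spine ())
  nonHead-lam nh (lamC h) = nh h

  nonHead-appL : ∀ {C c} → NotSpine C → NonHead (appL C c)
  nonHead-appL ns (spine (appL _ s)) = ns s

  nonHead-appR : ∀ {C c} → NonHead (appR c C)
  nonHead-appR (spine ())

  notSpine-appL : ∀ {C c} → NotSpine C → NotSpine (appL C c)
  notSpine-appL ns (appL _ s) = ns s

  notSpine-appR : ∀ {C c} → NotSpine (appR c C)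
  notSpine-appR ()

  notSpine-lam : ∀ {C} → NotSpine (lamC C)
  notSpine-lam ()

  ⇛-steps : ∀ {t u} → t ⇛ u → Star (Cl AnyCtx) t u
  Internal-steps : ∀ {t u} → Internal t u → Star (Cl NonHead) t u
  InternalFn-steps : ∀ {t u} → InternalFn t u → Star (Cl NotSpine) t u
  ⇛-steps (factored hs d) =
    gmap id (weaken _ ∘ Head-ctx) hs ◅◅ gmap id (weaken _) (Internal-steps d)
  Internal-steps var         = ε
  Internal-steps plus        = ε
  Internal-steps (lam d)     = gmap lam (underLam nonHead-lam) (Internal-steps d)
  Internal-steps (app da db) =
    gmap (λ z → app z _) (underAppL nonHead-appL) (InternalFn-steps da)
    ◅◅ gmap (app _) (underAppR (λ _ → nonHead-appR)) (⇛-steps db)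
  InternalFn-steps var         = ε
  InternalFn-steps plus        = ε
  InternalFn-steps (lam d)     = gmap lam (underLam (λ _ → notSpine-lam)) (⇛-steps d)
  InternalFn-steps (app da db) =
    gmap (λ z → app z _) (underAppL notSpine-appL) (InternalFn-steps da)
    ◅◅ gmap (app _) (underAppR (λ _ → notSpine-appR)) (⇛-steps db)

  plug-Step : ∀ (C : Ctx) {r r'} → Root r r' → Step (plug C r) (plug C r')
  plug-Step hole       r = root r
  plug-Step (appR t C) r = appR (plug-Step C r)
  plug-Step (appL C t) r = appL (plug-Step C r)
  plug-Step (lamC C)   r = lamS (plug-Step C r)

  closure-Step : ∀ {R : Rel Tm 0ℓ} → R ⇒ Root → Closure AnyCtx R ⇒ Step
  closure-Step f (ctx C _ r) = plug-Step C (f r)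

  factorization : ∀ {t u} → Star Step t u → (Star (Cl IsHead) · Star (Cl NonHead)) t u
  factorization ss with Steps⇛ ss
  ... | factored hs d = _ , gmap id Head-ctx hs , Internal-steps d

module Only⊕ = HeadFactorization ⊥

Only⊕-root : ∀ {P t u} → Closure P Only⊕.Root t u → Closure P _↦⊕_ t u
Only⊕-root (ctx C p (Only⊕.rβ () _))
Only⊕-root (ctx C p (Only⊕.r⊕ r)) = ctx C p r

⊕-factorization : Star _→⊕_ ⇒ (Star _→h⊕_ · Star _→¬h⊕_)
⊕-factorization ss with Only⊕.factorization (gmap id (Only⊕.closure-Step Only⊕.r⊕) ss)
... | s , hs , ns = s , gmap id Only⊕-root hs , gmap id Only⊕-root ns

module β⊕ = HeadFactorization ⊤

β⊕-step : (_→β_ ∪ _→⊕_) ⇒ β⊕.Step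
β⊕-step (inj₁ s) = β⊕.closure-Step (β⊕.rβ tt) s
β⊕-step (inj₂ s) = β⊕.closure-Step β⊕.r⊕ s

β⊕-root : ∀ {P t u} → Closure P β⊕.Root t u → (Closure P _↦β_ ∪ Closure P _↦⊕_) t u
β⊕-root (ctx C p (β⊕.rβ _ r)) = inj₁ (ctx C p r)
β⊕-root (ctx C p (β⊕.r⊕ r))   = inj₂ (ctx C p r)

β⊕-factorization : Star (_→β_ ∪ _→⊕_) ⇒ (Star (_→hβ_ ∪ _→h⊕_) · Star (_→¬hβ_ ∪ _→¬h⊕_))
β⊕-factorization ss with β⊕.factorization (gmap id β⊕-step ss)
... | s , hs , ns = s , gmap id β⊕-root hs , gmap id β⊕-root ns

-- The ⊕-redex is
-- ⊕ t p and the β-step lies inside t or inside p (a non-head context cannot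
-- reach the ⊕ itself). Firing ⊕ first either discards the β-step or keeps it.
-- The context must be appR _ C (step in p) or appL (appR _ C) _ (step in t);
-- every other shape is either a head context or cannot plug to ⊕ t p.
nonHeadβ-⊕-swap : (_→¬hβ_ · _↦⊕_) ⇒ (_→h⊕_ · ReflClosure _→β_)
nonHeadβ-⊕-swap (_ , ctx C nh β-step , ⊕-step) = swap C nh β-step ⊕-step
  where
  ⊕-at-root : ∀ {t p c} → app (app plus t) p ↦⊕ c → app (app plus t) p →h⊕ c
  ⊕-at-root = ctx hole (spine hole)

  swap : ∀ (C : Ctx) {r r' c} → NonHead C → r ↦β r' → plug C r' ↦⊕ c →
         (_→h⊕_ · ReflClosure _→β_) (plug C r) c
  swap (appR _ C) _ _ (plusL _ _) = _ , ⊕-at-root (plusL _ _) , rrefl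
  swap (appR _ C) _ β (plusR _ _) = _ , ⊕-at-root (plusR _ _) , [ ctx C tt β ]
  swap (appL (appR _ C) _) _ β (plusL _ _) = _ , ⊕-at-root (plusL _ _) , [ ctx C tt β ]
  swap (appL (appR _ C) _) _ _ (plusR _ _) = _ , ⊕-at-root (plusR _ _) , rrefl
  swap hole                  nh _ _ = ⊥-elim (nh (spine hole))
  swap (appL hole _)         nh _ _ = ⊥-elim (nh (spine (appL _ hole)))
  swap (appL (appL hole _) _) nh _ _ = ⊥-elim (nh (spine (appL _ (appL _ hole))))
  swap (lamC C) _ _ ()
  swap (appL (lamC C) _) _ _ ()
  swap (appL (appL (lamC C) _) _) _ _ ()
  swap (appL (appL (appR _ C) _) _) _ _ ()
  swap (appL (appL (appL C _) _) _) _ _ ()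

⊕-substitutive : Substitutive _↦⊕_
⊕-substitutive (plusL _ _) _ _ = plusL _ _
⊕-substitutive (plusR _ _) _ _ = plusR _ _

theorem5p3 : (Star _→⊕_ ⇒ (Star _→h⊕_ · Star _→¬h⊕_))
    × ((_→¬hβ_ · _↦⊕_) ⇒ (_→h⊕_ · ReflClosure _→β_))
    × Substitutive _↦⊕_
    × (Star (_→β_ ∪ _→⊕_) ⇒ (Star (_→hβ_ ∪ _→h⊕_) · Star (_→¬hβ_ ∪ _→¬h⊕_)))
theorem5p3 = ⊕-factorization , nonHeadβ-⊕-swap , ⊕-substitutive , β⊕-factorization
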